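{- Let $0<\varepsilon<1$ and let $\mathcal{J}$ be a uniform FSAP instance with parameter $\mathtt{Max}$ such that $k = \lceil W/\mathtt{Max} \rceil \le 1/\varepsilon$ and $\lfloor \varepsilon \mathtt{Max}/4 \rfloor \ge 1$. Partition the colors $\{1,\dots,W\}$ into consecutive strips $C_1, C_2, \dots, C_N$ (in increasing order of colors), each of size $\lfloor \varepsilon \mathtt{Max}/4 \rfloor$ except possibly the last one, which may be smaller. Then any optimal solution for $\mathcal{J}$ can be converted into a feasible FSAP solution in which the set of colors assigned to each interval is a union of whole strips (an integral number of strips), and whose total profit is at least $(1-\varepsilon)\, OPT_{FSAP}(\mathcal{J})$.
   Context: An instance of FSAP consists of an integer $W>0$ (colors $C=\{1,\dots,W\}$) and $n$ jobs $J_1,\dots,J_n$; job $J_i$ is the half-open interval $[s_i,e_i)$, has an integer maximum requirement $r_{max}(i)$ with $0\le r_{max}(i)\le W$, and profit $p_i\ge 1$ per allocated unit. A feasible solution assigns to each $J_i$ a set $c(J_i)$ of consecutive colors in $\{1,\dots,W\}$ (possibly empty) with $|c(J_i)|\le r_{max}(i)$, such that $c(J_i)\cap c(J_j)=\emptyset$ whenever $J_i$ and $J_j$ intersect. The profit is $\sum_i p_i|c(J_i)|$; $OPT_{FSAP}(\mathcal{J})$ is the maximum profit. An instance is uniform if there is an integer $1\le \mathtt{Max}\le W$ with $r_{max}(i)=\mathtt{Max}$ and $p_i=1$ for all $i$. -}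

module Defs where

open import Data.Nat using (ℕ; zero; suc; _+_; _*_; _∸_; _≤_; _<_)
open import Data.Nat.DivMod using (_/_)
open import Data.Fin using (Fin)
open import Data.Product using (_×_; Σ; _,_; proj₁; proj₂)
open import Data.Sum using (_⊎_)
open import Relation.Binary.PropositionalEquality using (_≡_; _≢_)
open import Relation.Nullary using (¬_)
open import Function.Bundles using (_⇔_)

-- floor division (value at divisor 0 irrelevant; only used with nonzero divisors)
divFloor : ℕ → ℕ → ℕ
divFloor m zero    = 0
divFloor m (suc d) = m / suc d

divCeil : ℕ → ℕ → ℕ
divCeil m zero    = 0
divCeil m (suc d) = (m + d) / suc d

-- A job: half-open interval [start , end)
record Job : Set where
  constructor job
  field
    start : ℕ
    end   : ℕ
open Job public

Intersect : Job → Job → Set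
Intersect J K = (start J < end K) × (start K < end J)

-- A uniform FSAP instance: W colors, n jobs, every job has r_max = Max, p = 1
record UniformInstance : Set where
  constructor uinst
  field
    W    : ℕ
    Max  : ℕ
    n    : ℕ
    jobs : Fin n → Job
open UniformInstance public

-- An assignment of consecutive colors to each job: job i gets
-- {first i , first i + 1 , … , first i + len i - 1}  (empty when len i = 0)
record Assignment (n : ℕ) : Set where
  constructor assign
  field
    first : Fin n → ℕ
    len   : Fin n → ℕ
open Assignment public

HasColor : ∀ {n} → Assignment n → Fin n → ℕ → Set
HasColor A i c = (first A i ≤ c) × (c < first A i + len A i)

Feasible : (I : UniformInstance) → Assignment (n I) → Set
Feasible I A =
  ((i : Fin (n I)) → len A i ≤ Max I)
  × ((i : Fin (n I)) → (c : ℕ) → HasColor A i c → (1 ≤ c) × (c ≤ W I))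
  × ((i j : Fin (n I)) → i ≢ j → Intersect (jobs I i) (jobs I j) →
       (c : ℕ) → ¬ (HasColor A i c × HasColor A j c))

sumFin : ∀ n → (Fin n → ℕ) → ℕ
sumFin zero    f = 0
sumFin (suc n) f = f Fin.zero + sumFin n (λ i → f (Fin.suc i))

profit : ∀ {n} → Assignment n → ℕ
profit {n} A = sumFin n (len A)

Optimal : (I : UniformInstance) → Assignment (n I) → Set
Optimal I A = Feasible I A × ((B : Assignment (n I)) → Feasible I B → profit B ≤ profit A)

-- strip index of color c (colors 1..W, strips of size s, C_1 = {1..s}, C_2 = {s+1..2s}, …)
stripOf : ℕ → ℕ → ℕ
stripOf s c = divFloor (c ∸ 1) s

-- every c(J_i) is a union of whole strips: two colors of {1..W} in the same strip
-- are either both in c(J_i) or both not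
StripAligned : (I : UniformInstance) → ℕ → Assignment (n I) → Set
StripAligned I s A =
  (i : Fin (n I)) → (c d : ℕ) → 1 ≤ c → c ≤ W I → 1 ≤ d → d ≤ W I →
    stripOf s c ≡ stripOf s d → (HasColor A i c ⇔ HasColor A i d)

-- Cut the colours into strips of size S and round every colour to a colour of
-- maximal load (number of jobs using it) in its strip.  Rounding is monotone,
-- so the colours whose rounded colour a job uses form an interval [L, H), a
-- union of whole strips; two interfering jobs never share a rounded colour, and
-- summing loads shows that the total length of these intervals is at least the
-- profit of the original solution.  [L, H) has at most Max + 2S colours, and
-- cutting it at a strip boundary E <= L + Max leaves at least Max - 2S of them,
-- a fraction (Max - 2S)/(Max + 2S) >= 1 - 4S/Max >= 1 - a/b.
module Submission where

open import Data.Nat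
  using (ℕ; zero; suc; _+_; _*_; _∸_; _⊓_; _≤_; _<_; z≤n; s≤s; s≤s⁻¹; _≤?_; _<?_; NonZero; >-nonZero)
open import Data.Nat.Properties
open import Data.Nat.DivMod
open import Algebra.Properties.CommutativeSemigroup +-commutativeSemigroup using (interchange)
open import Data.Nat.Solver using (module +-*-Solver)
open import Data.Fin using (Fin)
open import Data.List using (applyUpTo)
open import Data.List.Extrema.Nat using (argmax; argmax-all; f[xs]≤f[argmax])
open import Data.List.Relation.Unary.All.Properties using (applyUpTo⁺₁; applyUpTo⁻)
open import Data.Product using (_×_; Σ; ∃-syntax; _,_; proj₁; proj₂)
open import Data.Sum using (inj₁; inj₂)
open import Function.Base using (_∘_)
open import Function.Bundles using (_⇔_; mk⇔; Equivalence)
open import Function.Properties.Equivalence using () renaming (refl to ⇔-refl)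
open import Relation.Nullary using (¬_; Dec; yes; no; contradiction)
open import Relation.Nullary.Decidable using (_×-dec_)
open import Relation.Unary using (Decidable)
open import Relation.Binary.PropositionalEquality
open import Defs

open +-*-Solver
open Equivalence using (to; from)

𝟙 : {P : Set} → Dec P → ℕ
𝟙 (yes _) = 1
𝟙 (no _)  = 0

𝟙-cong : {P Q : Set} → P ⇔ Q → (P? : Dec P) (Q? : Dec Q) → 𝟙 P? ≡ 𝟙 Q?
𝟙-cong P⇔Q (yes _) (yes _) = refl
𝟙-cong P⇔Q (yes p) (no ¬q) = contradiction (to P⇔Q p) ¬q
𝟙-cong P⇔Q (no ¬p) (yes q) = contradiction (from P⇔Q q) ¬p
𝟙-cong P⇔Q (no _)  (no _)  = refl

𝟙-no : {P : Set} → ¬ P → (P? : Dec P) → 𝟙 P? ≡ 0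
𝟙-no ¬p (yes p) = contradiction p ¬p
𝟙-no ¬p (no _)  = refl

sumBelow : ℕ → (ℕ → ℕ) → ℕ
sumBelow zero    f = 0
sumBelow (suc w) f = sumBelow w f + f w

sumBelow-cong : ∀ w {f g : ℕ → ℕ} → (∀ {x} → x < w → f x ≡ g x) → sumBelow w f ≡ sumBelow w g
sumBelow-cong zero    f≡g = refl
sumBelow-cong (suc w) f≡g = cong₂ _+_ (sumBelow-cong w (λ x<w → f≡g (m≤n⇒m≤1+n x<w))) (f≡g ≤-refl)

sumBelow-mono : ∀ w {f g : ℕ → ℕ} → (∀ x → f x ≤ g x) → sumBelow w f ≤ sumBelow w g
sumBelow-mono zero    f≤g = z≤n
sumBelow-mono (suc w) f≤g = +-mono-≤ (sumBelow-mono w f≤g) (f≤g w)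

sumFin-cong : ∀ k {f g : Fin k → ℕ} → (∀ i → f i ≡ g i) → sumFin k f ≡ sumFin k g
sumFin-cong zero    f≡g = refl
sumFin-cong (suc k) f≡g = cong₂ _+_ (f≡g Fin.zero) (sumFin-cong k (λ i → f≡g (Fin.suc i)))

sumFin-mono : ∀ k {f g : Fin k → ℕ} → (∀ i → f i ≤ g i) → sumFin k f ≤ sumFin k g
sumFin-mono zero    f≤g = z≤n
sumFin-mono (suc k) f≤g = +-mono-≤ (f≤g Fin.zero) (sumFin-mono k (λ i → f≤g (Fin.suc i)))

sumFin-zero : ∀ k → sumFin k (λ _ → 0) ≡ 0
sumFin-zero zero    = refl
sumFin-zero (suc k) = sumFin-zero k

sumFin-+ : ∀ k (f g : Fin k → ℕ) → sumFin k (λ i → f i + g i) ≡ sumFin k f + sumFin k g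
sumFin-+ zero    f g = refl
sumFin-+ (suc k) f g =
  trans (cong (f Fin.zero + g Fin.zero +_) (sumFin-+ k (λ i → f (Fin.suc i)) (λ i → g (Fin.suc i))))
        (interchange (f Fin.zero) (g Fin.zero) _ _)

*-distribˡ-sumFin : ∀ k c (f : Fin k → ℕ) → c * sumFin k f ≡ sumFin k (λ i → c * f i)
*-distribˡ-sumFin zero    c f = *-zeroʳ c
*-distribˡ-sumFin (suc k) c f =
  trans (*-distribˡ-+ c (f Fin.zero) _) (cong (c * f Fin.zero +_) (*-distribˡ-sumFin k c (λ i → f (Fin.suc i))))

sumBelow-sumFin-comm : ∀ w k (g : Fin k → ℕ → ℕ) →
  sumBelow w (λ x → sumFin k (λ i → g i x)) ≡ sumFin k (λ i → sumBelow w (g i))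
sumBelow-sumFin-comm zero    k g = sym (sumFin-zero k)
sumBelow-sumFin-comm (suc w) k g =
  trans (cong (_+ sumFin k (λ i → g i w)) (sumBelow-sumFin-comm w k g))
        (sym (sumFin-+ k (λ i → sumBelow w (g i)) (λ i → g i w)))

inInterval? : ∀ lo hi x → Dec (lo ≤ x × x < hi)
inInterval? lo hi x = (lo ≤? x) ×-dec (x <? hi)

count-interval : ∀ {w lo hi} → hi ≤ w → sumBelow w (λ x → 𝟙 (inInterval? lo hi x)) ≡ hi ∸ lo
count-interval {zero}  {lo} z≤n = sym (0∸n≡0 lo)
count-interval {suc w} {lo} {hi} hi≤1+w with m≤n⇒m<n∨m≡n hi≤1+w
... | inj₁ hi<1+w = begin
  sumBelow w (λ x → 𝟙 (inInterval? lo hi x)) + 𝟙 (inInterval? lo hi w)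
    ≡⟨ cong₂ _+_ (count-interval (s≤s⁻¹ hi<1+w)) (𝟙-no w∉interval _) ⟩
  (hi ∸ lo) + 0
    ≡⟨ +-identityʳ _ ⟩
  hi ∸ lo ∎
  where
  open ≡-Reasoning
  w∉interval : ¬ (lo ≤ w × w < hi)
  w∉interval (_ , w<hi) = <⇒≱ w<hi (s≤s⁻¹ hi<1+w)
... | inj₂ refl = begin
  sumBelow w (λ x → 𝟙 (inInterval? lo (suc w) x)) + 𝟙 (inInterval? lo (suc w) w)
    ≡⟨ cong (_+ 𝟙 (inInterval? lo (suc w) w)) (sumBelow-cong w (λ x<w → 𝟙-cong (below-w x<w) _ _)) ⟩
  sumBelow w (λ x → 𝟙 (inInterval? lo w x)) + 𝟙 (inInterval? lo (suc w) w)
    ≡⟨ cong (_+ 𝟙 (inInterval? lo (suc w) w)) (count-interval {w} {lo} ≤-refl) ⟩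
  (w ∸ lo) + 𝟙 (inInterval? lo (suc w) w)
    ≡⟨ last-point (lo ≤? w) ⟩
  suc w ∸ lo ∎
  where
  open ≡-Reasoning
  below-w : ∀ {x} → x < w → (lo ≤ x × x < suc w) ⇔ (lo ≤ x × x < w)
  below-w x<w = mk⇔ (λ (lo≤x , _) → lo≤x , x<w) (λ (lo≤x , _) → lo≤x , m≤n⇒m≤1+n x<w)
  last-point : Dec (lo ≤ w) → (w ∸ lo) + 𝟙 (inInterval? lo (suc w) w) ≡ suc w ∸ lo
  last-point (yes lo≤w) = begin
    (w ∸ lo) + 𝟙 (inInterval? lo (suc w) w) ≡⟨ cong ((w ∸ lo) +_) (𝟙-cong (mk⇔ proj₁ (_, ≤-refl)) _ (yes lo≤w)) ⟩
    (w ∸ lo) + 1                            ≡⟨ +-comm (w ∸ lo) 1 ⟩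
    suc (w ∸ lo)                            ≡⟨ +-∸-assoc 1 lo≤w ⟨
    suc w ∸ lo                              ∎
  last-point (no lo≰w) = begin
    (w ∸ lo) + 𝟙 (inInterval? lo (suc w) w) ≡⟨ cong₂ _+_ (m≤n⇒m∸n≡0 (<⇒≤ w<lo)) (𝟙-no (lo≰w ∘ proj₁) _) ⟩
    0                                       ≡⟨ m≤n⇒m∸n≡0 w<lo ⟨
    suc w ∸ lo                              ∎
    where
    w<lo : w < lo
    w<lo = ≰⇒> lo≰w

module _ {P : ℕ → Set} (P? : Decidable P) (P-downClosed : ∀ {x y} → x ≤ y → P y → P x) where

  initialSegment : ∀ w → ∃[ c ] c ≤ w × (∀ {x} → x < w → P x ⇔ x < c)
  initialSegment zero = 0 , z≤n , λ ()
  initialSegment (suc w) with initialSegment w | P? w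
  ... | _ , _ , _ | yes Pw =
    suc w , ≤-refl , λ x<1+w → mk⇔ (λ _ → x<1+w) (λ _ → P-downClosed (s≤s⁻¹ x<1+w) Pw)
  ... | c , c≤w , below-w | no ¬Pw = c , m≤n⇒m≤1+n c≤w , below-1+w
    where
    below-1+w : ∀ {x} → x < suc w → P x ⇔ x < c
    below-1+w x<1+w with m<1+n⇒m<n∨m≡n x<1+w
    ... | inj₁ x<w  = below-w x<w
    ... | inj₂ refl = mk⇔ (λ Pw → contradiction Pw ¬Pw) (λ w<c → contradiction c≤w (<⇒≱ w<c))

record PreimageInterval (σ : ℕ → ℕ) (w lo hi : ℕ) : Set where
  field
    lower upper : ℕ
    upper≤w : upper ≤ w
    ∈⇔ : ∀ {x} → x < w → (lo ≤ σ x × σ x < hi) ⇔ (lower ≤ x × x < upper)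

preimage-interval : ∀ {σ} → (∀ {x y} → x ≤ y → σ x ≤ σ y) → ∀ w lo hi → PreimageInterval σ w lo hi
preimage-interval {σ} σ-mono w lo hi
  with initialSegment (λ x → σ x <? lo) (λ x≤y → ≤-<-trans (σ-mono x≤y)) w
     | initialSegment (λ x → σ x <? hi) (λ x≤y → ≤-<-trans (σ-mono x≤y)) w
... | L , _ , below-L | H , H≤w , below-H = record
  { lower = L ; upper = H ; upper≤w = H≤w ; ∈⇔ = λ x<w →
    mk⇔ (λ (lo≤σx , σx<hi) → ≮⇒≥ (λ x<L → <⇒≱ (from (below-L x<w) x<L) lo≤σx) , to (below-H x<w) σx<hi)
        (λ (L≤x , x<H) → ≮⇒≥ (λ σx<lo → <⇒≱ (to (below-L x<w) σx<lo) L≤x) , from (below-H x<w) x<H) }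

lo≤x<lo+[hi∸lo]⇔lo≤x<hi : ∀ {lo hi x} → (lo ≤ x × x < lo + (hi ∸ lo)) ⇔ (lo ≤ x × x < hi)
lo≤x<lo+[hi∸lo]⇔lo≤x<hi {lo} {hi} {x} with lo ≤? hi
... | yes lo≤hi = subst (λ t → (lo ≤ x × x < t) ⇔ (lo ≤ x × x < hi)) (sym (m+[n∸m]≡n lo≤hi)) ⇔-refl
... | no lo≰hi = mk⇔ (λ (lo≤x , x<top) → contradiction (≤-<-trans lo≤x x<top) lo≮top)
                     (λ (lo≤x , x<hi) → contradiction (≤-trans lo≤x (<⇒≤ x<hi)) lo≰hi)
  where
  top≡lo : lo + (hi ∸ lo) ≡ lo
  top≡lo = trans (cong (lo +_) (m≤n⇒m∸n≡0 (<⇒≤ (≰⇒> lo≰hi)))) (+-identityʳ lo)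
  lo≮top : ¬ lo < lo + (hi ∸ lo)
  lo≮top = subst (λ t → ¬ lo < t) (sym top≡lo) (<-irrefl refl)

divFloor≡/ : ∀ m n .{{_ : NonZero n}} → divFloor m n ≡ m / n
divFloor≡/ m (suc n) = refl

divFloor*n≤m : ∀ m n → divFloor m n * n ≤ m
divFloor*n≤m m zero    = z≤n
divFloor*n≤m m (suc n) = m/n*n≤m m (suc n)

m≡[m/n]*n+m%n : ∀ m n .{{_ : NonZero n}} → m ≡ (m / n) * n + m % n
m≡[m/n]*n+m%n m n = trans (m≡m%n+[m/n]*n m n) (+-comm (m % n) _)

m<[1+m/n]*n : ∀ m n .{{_ : NonZero n}} → m < suc (m / n) * n
m<[1+m/n]*n m n = begin-strict
  m                   ≡⟨ m≡m%n+[m/n]*n m n ⟩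
  m % n + (m / n) * n <⟨ +-monoˡ-< _ (m%n<n m n) ⟩
  n + (m / n) * n     ∎
  where open ≤-Reasoning

m<n*o⇔m/o<n : ∀ m n o .{{_ : NonZero o}} → m < n * o ⇔ m / o < n
m<n*o⇔m/o<n m n o = mk⇔ m<n*o⇒m/o<n (λ m/o<n → <-≤-trans (m<[1+m/n]*n m o) (*-monoˡ-≤ o m/o<n))

[o*n+r]/n≡o : ∀ o {n r} .{{_ : NonZero n}} → r < n → (o * n + r) / n ≡ o
[o*n+r]/n≡o o {n} {r} r<n = ≤-antisym
  (s≤s⁻¹ (m<n*o⇒m/o<n (subst (o * n + r <_) (+-comm (o * n) n) (+-monoʳ-< (o * n) r<n))))
  (subst (_≤ (o * n + r) / n) (m*n/n≡m o n) (/-monoˡ-≤ n (m≤m+n (o * n) r)))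

m/o≡n/o⇒m<n+o : ∀ {m n o} .{{_ : NonZero o}} → m / o ≡ n / o → m < n + o
m/o≡n/o⇒m<n+o {m} {n} {o} m/o≡n/o = begin-strict
  m               <⟨ m<[1+m/n]*n m o ⟩
  o + (m / o) * o ≡⟨ cong (λ q → o + q * o) m/o≡n/o ⟩
  o + (n / o) * o ≤⟨ +-monoʳ-≤ o (m/n*n≤m n o) ⟩
  o + n           ≡⟨ +-comm o n ⟩
  n + o           ∎
  where open ≤-Reasoning

m/o<n/o⇒m<n : ∀ {m n o} .{{_ : NonZero o}} → m / o < n / o → m < n
m/o<n/o⇒m<n {o = o} m/o<n/o = ≰⇒> (λ n≤m → <⇒≱ m/o<n/o (/-monoˡ-≤ o n≤m))

module StripMaximiser (u : ℕ → ℕ) (S : ℕ) .{{_ : NonZero S}} where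

  best : ℕ → ℕ
  best q = argmax u (q * S) (applyUpTo (q * S +_) S)

  round : ℕ → ℕ
  round x = best (x / S)

  round-/ : ∀ x → round x / S ≡ x / S
  round-/ x = argmax-all u {P = λ y → y / S ≡ q} (m*n/n≡m q S) (applyUpTo⁺₁ (q * S +_) S ([o*n+r]/n≡o q))
    where
    q : ℕ
    q = x / S

  u≤u∘round : ∀ x → u x ≤ u (round x)
  u≤u∘round x = subst (λ y → u y ≤ u (round x)) (sym (m≡[m/n]*n+m%n x S))
    (applyUpTo⁻ (q * S +_) S (f[xs]≤f[argmax] {f = u} (q * S) (applyUpTo (q * S +_) S)) (m%n<n x S))
    where
    q : ℕ
    q = x / S

  round-mono : ∀ {x y} → x ≤ y → round x ≤ round y
  round-mono {x} {y} x≤y with m≤n⇒m<n∨m≡n (/-monoˡ-≤ S x≤y)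
  ... | inj₁ x/S<y/S = <⇒≤ (m/o<n/o⇒m<n (subst₂ _<_ (sym (round-/ x)) (sym (round-/ y)) x/S<y/S))
  ... | inj₂ x/S≡y/S = ≤-reflexive (cong best x/S≡y/S)

  x<round[x]+S : ∀ x → x < round x + S
  x<round[x]+S x = m/o≡n/o⇒m<n+o (sym (round-/ x))

  round[x]<x+S : ∀ x → round x < x + S
  round[x]<x+S x = m/o≡n/o⇒m<n+o (round-/ x)

capping-loss : ∀ {a b s M X Y} → a ≤ b → s * (4 * b) ≤ a * M → Y ≤ M + 2 * s → M ≤ X + 2 * s →
  (b ∸ a) * Y ≤ b * X
capping-loss {a} {b} {s} {M} {X} {Y} a≤b 4sb≤aM Y≤M+2s M≤X+2s = +-cancelʳ-≤ (b * (2 * s)) _ _ (begin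
  (b ∸ a) * Y + b * (2 * s)             ≤⟨ +-monoˡ-≤ _ (*-monoʳ-≤ (b ∸ a) Y≤M+2s) ⟩
  (b ∸ a) * (M + 2 * s) + b * (2 * s)   ≡⟨ regroup (b ∸ a) M s b ⟩
  (b ∸ a) * M + (b ∸ a + b) * (2 * s)   ≤⟨ +-monoʳ-≤ _ (*-monoˡ-≤ (2 * s) (+-monoˡ-≤ b (m∸n≤m b a))) ⟩
  (b ∸ a) * M + (b + b) * (2 * s)       ≡⟨ cong ((b ∸ a) * M +_) (double s b) ⟩
  (b ∸ a) * M + s * (4 * b)             ≤⟨ +-monoʳ-≤ _ 4sb≤aM ⟩
  (b ∸ a) * M + a * M                   ≡⟨ *-distribʳ-+ M (b ∸ a) a ⟨
  (b ∸ a + a) * M                       ≡⟨ cong (_* M) (m∸n+n≡m a≤b) ⟩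
  b * M                                 ≤⟨ *-monoʳ-≤ b M≤X+2s ⟩
  b * (X + 2 * s)                       ≡⟨ *-distribˡ-+ b X (2 * s) ⟩
  b * X + b * (2 * s)                   ∎)
  where
  open ≤-Reasoning
  regroup : ∀ d M s b → d * (M + 2 * s) + b * (2 * s) ≡ d * M + (d + b) * (2 * s)
  regroup = solve 4 (λ d M s b → d :* (M :+ con 2 :* s) :+ b :* (con 2 :* s)
                                 := d :* M :+ (d :+ b) :* (con 2 :* s)) refl
  double : ∀ s b → (b + b) * (2 * s) ≡ s * (4 * b)
  double = solve 2 (λ s b → (b :+ b) :* (con 2 :* s) := s :* (con 4 :* b)) refl

hasColor? : ∀ {k} (A : Assignment k) i c → Dec (HasColor A i c)
hasColor? A i = inInterval? (first A i) (first A i + len A i)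

len≤colourCount : ∀ {k} (A : Assignment k) i w → (∀ c → HasColor A i c → 1 ≤ c × c ≤ w) →
  len A i ≤ sumBelow w (λ x → 𝟙 (hasColor? A i (suc x)))
len≤colourCount A i w inRange = count (first A i) (len A i) inRange
  where
  count : ∀ f l → (∀ c → f ≤ c × c < f + l → 1 ≤ c × c ≤ w) →
    l ≤ sumBelow w (λ x → 𝟙 (inInterval? f (f + l) (suc x)))
  count f zero _ = z≤n
  count zero (suc l) inRange with inRange 0 (z≤n , s≤s z≤n)
  ... | () , _
  count (suc f) (suc l) inRange = ≤-reflexive (sym (begin
    sumBelow w (λ x → 𝟙 (inInterval? (suc f) (suc f + suc l) (suc x)))
      ≡⟨ sumBelow-cong w (λ _ → 𝟙-cong (mk⇔ (λ (p , q) → s≤s⁻¹ p , s≤s⁻¹ q) (λ (p , q) → s≤s p , s≤s q)) _ _) ⟩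
    sumBelow w (λ x → 𝟙 (inInterval? f (f + suc l) x))
      ≡⟨ count-interval top≤w ⟩
    f + suc l ∸ f
      ≡⟨ m+n∸m≡n f (suc l) ⟩
    suc l ∎))
    where
    open ≡-Reasoning
    top≤w : f + suc l ≤ w
    top≤w = proj₂ (inRange (f + suc l) (subst (suc f ≤_) (sym (+-suc f l)) (s≤s (m≤m+n f l)) , ≤-refl))

module StripRounding (I : UniformInstance) (A : Assignment (n I)) (A-feasible : Feasible I A)
                     (S : ℕ) .{{_ : NonZero S}} where

  -- Colour c is handled through its index x = c - 1, so the colours are the x < W.
  load : ℕ → ℕ
  load x = sumFin (n I) (λ i → 𝟙 (hasColor? A i (suc x)))

  open StripMaximiser load S

  module RoundedInterval (i : Fin (n I)) where

    opaque
      preimage : PreimageInterval (λ x → suc (round x)) (W I) (first A i) (first A i + len A i)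
      preimage = preimage-interval (λ x≤y → s≤s (round-mono x≤y)) (W I) (first A i) (first A i + len A i)

    open PreimageInterval preimage public
      renaming (lower to L; upper to H; upper≤w to H≤W; ∈⇔ to uses-round⇔)

    E : ℕ
    E = (L / S + Max I / S) * S

  open RoundedInterval

  B : Assignment (n I)
  B = assign (λ i → suc (L i)) (λ i → H i ⊓ E i ∸ L i)

  module _ (i : Fin (n I)) where

    B-uses⇔ : ∀ {x} → HasColor B i (suc x) ⇔ (L i ≤ x × x < H i ⊓ E i)
    B-uses⇔ {x} = mk⇔ (λ (p , q) → to interval (s≤s⁻¹ p , s≤s⁻¹ q))
                      (λ r → let (p , q) = from interval r in s≤s p , s≤s q)
      where
      interval : (L i ≤ x × x < L i + (H i ⊓ E i ∸ L i)) ⇔ (L i ≤ x × x < H i ⊓ E i)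
      interval = lo≤x<lo+[hi∸lo]⇔lo≤x<hi

    B-uses⇒<W : ∀ {x} → HasColor B i (suc x) → x < W I
    B-uses⇒<W uses = <-≤-trans (proj₂ (to B-uses⇔ uses)) (≤-trans (m⊓n≤m (H i) (E i)) (H≤W i))

    B-uses⇔A-uses-round : ∀ {x} → x < W I →
      HasColor B i (suc x) ⇔ (HasColor A i (suc (round x)) × x / S < L i / S + Max I / S)
    B-uses⇔A-uses-round {x} x<W = mk⇔
      (λ uses → let (L≤x , x<H⊓E) = to B-uses⇔ uses in
        from (uses-round⇔ i x<W) (L≤x , <-≤-trans x<H⊓E (m⊓n≤m (H i) (E i))) ,
        to (m<n*o⇔m/o<n x _ S) (<-≤-trans x<H⊓E (m⊓n≤n (H i) (E i))))
      (λ (usesA , x/S<k) → let (L≤x , x<H) = to (uses-round⇔ i x<W) usesA in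
        from B-uses⇔ (L≤x , ⊓-glb x<H (from (m<n*o⇔m/o<n x _ S) x/S<k)))

    len-B≤Max : len B i ≤ Max I
    len-B≤Max = begin
      H i ⊓ E i ∸ L i                ≤⟨ ∸-monoˡ-≤ (L i) (m⊓n≤n (H i) (E i)) ⟩
      E i ∸ L i                      ≤⟨ m≤n+o⇒m∸n≤o (E i) (L i) E≤L+⌊Max⌋ ⟩
      (Max I / S) * S                ≤⟨ m/n*n≤m (Max I) S ⟩
      Max I                          ∎
      where
      open ≤-Reasoning
      E≤L+⌊Max⌋ : E i ≤ L i + (Max I / S) * S
      E≤L+⌊Max⌋ = begin
        (L i / S + Max I / S) * S         ≡⟨ *-distribʳ-+ S (L i / S) (Max I / S) ⟩
        (L i / S) * S + (Max I / S) * S   ≤⟨ +-monoˡ-≤ _ (m/n*n≤m (L i) S) ⟩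
        L i + (Max I / S) * S             ∎

    y<x+len+2S : ∀ {x y} → x < W I → y < W I → L i ≤ x × x < H i → L i ≤ y × y < H i →
      y < x + (len A i + 2 * S)
    y<x+len+2S {x} {y} x<W y<W x∈ y∈ = begin-strict
      y                           <⟨ x<round[x]+S y ⟩
      round y + S                 <⟨ +-monoˡ-< S round[y]<round[x]+l ⟩
      round x + len A i + S       ≤⟨ +-monoˡ-≤ S (+-monoˡ-≤ (len A i) (<⇒≤ (round[x]<x+S x))) ⟩
      x + S + len A i + S         ≡⟨ regroup x S (len A i) ⟩
      x + (len A i + 2 * S)       ∎
      where
      open ≤-Reasoning
      round[y]<round[x]+l : round y < round x + len A i
      round[y]<round[x]+l = s≤s⁻¹ (<-≤-trans (proj₂ (from (uses-round⇔ i y<W) y∈))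
                                            (+-monoˡ-≤ (len A i) (proj₁ (from (uses-round⇔ i x<W) x∈))))
      regroup : ∀ x S l → x + S + l + S ≡ x + (l + 2 * S)
      regroup = solve 3 (λ x S l → x :+ S :+ l :+ S := x :+ (l :+ con 2 :* S)) refl

    H≤L+Max+2S : H i ≤ L i + (Max I + 2 * S)
    H≤L+Max+2S = ≮⇒≥ λ top<H →
      <-irrefl refl (<-≤-trans (top<top top<H) (+-monoʳ-≤ (L i) (+-monoˡ-≤ (2 * S) (proj₁ A-feasible i))))
      where
      top<top : L i + (Max I + 2 * S) < H i → L i + (Max I + 2 * S) < L i + (len A i + 2 * S)
      top<top top<H = y<x+len+2S (<-≤-trans L<H (H≤W i)) (<-≤-trans top<H (H≤W i)) (≤-refl , L<H) (m≤m+n (L i) _ , top<H)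
        where
        L<H : L i < H i
        L<H = ≤-<-trans (m≤m+n (L i) _) top<H

    Max≤E∸L+2S : Max I ≤ (E i ∸ L i) + 2 * S
    Max≤E∸L+2S = +-cancelˡ-≤ (L i) _ _ (begin
      L i + Max I                                     ≤⟨ +-mono-≤ (<⇒≤ (m<[1+m/n]*n (L i) S)) (<⇒≤ (m<[1+m/n]*n (Max I) S)) ⟩
      (S + (L i / S) * S) + (S + (Max I / S) * S)     ≡⟨ regroup (L i / S) (Max I / S) S ⟩
      E i + 2 * S                                     ≤⟨ +-monoˡ-≤ (2 * S) (m≤n+m∸n (E i) (L i)) ⟩
      L i + (E i ∸ L i) + 2 * S                       ≡⟨ +-assoc (L i) _ _ ⟩
      L i + ((E i ∸ L i) + 2 * S)                     ∎)
      where
      open ≤-Reasoning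
      regroup : ∀ p q S → (S + p * S) + (S + q * S) ≡ (p + q) * S + 2 * S
      regroup = solve 3 (λ p q S → (S :+ p :* S) :+ (S :+ q :* S) := (p :+ q) :* S :+ con 2 :* S) refl

    job-loss : ∀ {a b} → a ≤ b → S * (4 * b) ≤ a * Max I → (b ∸ a) * (H i ∸ L i) ≤ b * len B i
    job-loss {a} {b} a≤b 4Sb≤aMax with H i ≤? E i
    ... | yes H≤E rewrite m≤n⇒m⊓n≡m H≤E = *-monoˡ-≤ (H i ∸ L i) (m∸n≤m b a)
    ... | no H≰E rewrite m≥n⇒m⊓n≡n (<⇒≤ (≰⇒> H≰E)) =
      capping-loss {s = S} a≤b 4Sb≤aMax (m≤n+o⇒m∸n≤o (H i) (L i) H≤L+Max+2S) Max≤E∸L+2S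

  B-feasible : Feasible I B
  B-feasible = len-B≤Max , inRange , disjoint
    where
    inRange : ∀ i c → HasColor B i c → 1 ≤ c × c ≤ W I
    inRange i (suc x) uses = s≤s z≤n , B-uses⇒<W i uses
    disjoint : ∀ i j → i ≢ j → Intersect (jobs I i) (jobs I j) → ∀ c → ¬ (HasColor B i c × HasColor B j c)
    disjoint i j i≢j J∩K (suc x) (uses-i , uses-j) =
      proj₂ (proj₂ A-feasible) i j i≢j J∩K (suc (round x))
        (proj₁ (to (B-uses⇔A-uses-round i x<W) uses-i) , proj₁ (to (B-uses⇔A-uses-round j x<W) uses-j))
      where
      x<W : x < W I
      x<W = B-uses⇒<W i uses-i

  B-stripAligned : StripAligned I S B
  B-stripAligned i (suc x) (suc y) _ x<W _ y<W same-strip = mk⇔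
    (λ uses → from (B-uses⇔A-uses-round i y<W) (subst Rounded x/S≡y/S (to (B-uses⇔A-uses-round i x<W) uses)))
    (λ uses → from (B-uses⇔A-uses-round i x<W) (subst Rounded (sym x/S≡y/S) (to (B-uses⇔A-uses-round i y<W) uses)))
    where
    Rounded : ℕ → Set
    Rounded q = HasColor A i (suc (best q)) × q < L i / S + Max I / S
    x/S≡y/S : x / S ≡ y / S
    x/S≡y/S = trans (sym (divFloor≡/ x S)) (trans same-strip (divFloor≡/ y S))

  profit-A≤∑width : profit A ≤ sumFin (n I) (λ i → H i ∸ L i)
  profit-A≤∑width = begin
    sumFin (n I) (len A)
      ≤⟨ sumFin-mono (n I) (λ i → len≤colourCount A i (W I) (proj₁ (proj₂ A-feasible) i)) ⟩
    sumFin (n I) (λ i → sumBelow (W I) (λ x → 𝟙 (hasColor? A i (suc x))))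
      ≡⟨ sumBelow-sumFin-comm (W I) (n I) (λ i x → 𝟙 (hasColor? A i (suc x))) ⟨
    sumBelow (W I) load
      ≤⟨ sumBelow-mono (W I) u≤u∘round ⟩
    sumBelow (W I) (λ x → load (round x))
      ≡⟨ sumBelow-sumFin-comm (W I) (n I) (λ i x → 𝟙 (hasColor? A i (suc (round x)))) ⟩
    sumFin (n I) (λ i → sumBelow (W I) (λ x → 𝟙 (hasColor? A i (suc (round x)))))
      ≡⟨ sumFin-cong (n I) width ⟩
    sumFin (n I) (λ i → H i ∸ L i) ∎
    where
    open ≤-Reasoning
    width : ∀ i → sumBelow (W I) (λ x → 𝟙 (hasColor? A i (suc (round x)))) ≡ H i ∸ L i
    width i = trans (sumBelow-cong (W I) (λ {x} x<W → 𝟙-cong (uses-round⇔ i x<W) _ (inInterval? (L i) (H i) x)))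
                    (count-interval (H≤W i))

  profit-bound : ∀ {a b} → a ≤ b → S * (4 * b) ≤ a * Max I → (b ∸ a) * profit A ≤ b * profit B
  profit-bound {a} {b} a≤b 4Sb≤aMax = begin
    (b ∸ a) * profit A                          ≤⟨ *-monoʳ-≤ (b ∸ a) profit-A≤∑width ⟩
    (b ∸ a) * sumFin (n I) (λ i → H i ∸ L i)    ≡⟨ *-distribˡ-sumFin (n I) (b ∸ a) (λ i → H i ∸ L i) ⟩
    sumFin (n I) (λ i → (b ∸ a) * (H i ∸ L i))  ≤⟨ sumFin-mono (n I) (λ i → job-loss i a≤b 4Sb≤aMax) ⟩
    sumFin (n I) (λ i → b * len B i)            ≡⟨ *-distribˡ-sumFin (n I) b (len B) ⟨
    b * profit B                                ∎
    where open ≤-Reasoning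

lemma5 : (a b : ℕ) → 0 < a → a < b →
    (I : UniformInstance) → 1 ≤ Max I → Max I ≤ W I →
    divCeil (W I) (Max I) * a ≤ b →
    1 ≤ divFloor (a * Max I) (4 * b) →
    (A : Assignment (n I)) → Optimal I A →
    Σ (Assignment (n I)) (λ B →
      Feasible I B
      × StripAligned I (divFloor (a * Max I) (4 * b)) B
      × (b ∸ a) * profit A ≤ b * profit B)
lemma5 a b _ a<b I _ _ _ 1≤S A (A-feasible , _) =
  B , B-feasible , B-stripAligned , profit-bound (<⇒≤ a<b) (divFloor*n≤m (a * Max I) (4 * b))
  where open StripRounding I A A-feasible (divFloor (a * Max I) (4 * b)) {{>-nonZero 1≤S}}
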